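{- Let $T$ be a subdivided star with $\alpha(T)\ge3$ and let $G$ be a graph. Then an interesting partition $X_1,\dots,X_{\alpha(T)-1}$ of $V(G)$ is $T$-freeness certifying precisely if $G[X_i]$ is a clique for every $i>1$ and $G[X_1]$ is either a clique or a stable set.
   Context: Graphs are finite and simple; $\alpha(\cdot)$ is the stability number. A subdivided star is a tree obtained from a star (tree in which all but one vertex are leaves) by subdividing each edge exactly once. An interesting partition of $V(G)$ (with respect to $T$) is a partition $(X_1,\dots,X_{\alpha(T)-1})$ such that $\alpha(G[X_1])\ge\alpha(G[X_j])$ for all $j\ge2$ and each $G[X_i]$ contains either a clique or a stable set of size $|V(T)|$. A $T$-freeness witnessing partition of $G$ is a partition of $V(G)$ into $\alpha(T)-1$ parts $X_1,\dots,X_{\alpha(T)-1}$ such that for every partition $Y_1,\dots,Y_{\alpha(T)-1}$ of $V(T)$ there is an $i$ with $T[Y_i]$ not an induced subgraph of $G[X_i]$. It is $T$-freeness certifying if moreover (i) $\alpha(G[X_1])\ge\alpha(G[X_i])$ for $i\ge2$; (ii) for $i\ge2$, $G[X_i]$ contains a clique of size $|V(T)|$ and $G[X_1]$ contains a clique or a stable set of size $|V(T)|$; (iii) each $G[X_i]$ is $P_4$-free. -}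

module Defs where

open import Data.Bool using (Bool; true; false; _∧_; _∨_; not)
open import Data.Bool.Properties using (∨-comm)
open import Data.Nat using (ℕ; zero; suc; _+_; _≤_; _≡ᵇ_; _≤ᵇ_)
open import Data.Fin using (Fin; toℕ)
open import Data.Fin.Properties using (_≟_)
open import Data.Fin.Subset using (Subset; _∈_; _⊆_; ∣_∣; ⊤)
open import Data.Vec using (tabulate)
open import Data.Product using (Σ; _×_; ∃; ∃-syntax)
open import Data.Sum using (_⊎_)
open import Function.Bundles using (_⤖_; Bijection)
open import Relation.Nullary using (¬_; does; yes; no)
open import Relation.Binary.PropositionalEquality using (_≡_; _≢_; refl; sym)

record Graph (n : ℕ) : Set where
  field
    adj    : Fin n → Fin n → Bool
    adj-sym : ∀ u v → adj u v ≡ adj v u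
    adj-irr : ∀ v → adj v v ≡ false
open Graph public

mkGraph : ∀ {n} → (Fin n → Fin n → Bool) → Graph n
mkGraph {n} e = record { adj = a ; adj-sym = s ; adj-irr = i }
  where
  a : Fin n → Fin n → Bool
  a u v with u ≟ v
  ... | yes _ = false
  ... | no _  = e u v ∨ e v u
  s : ∀ u v → a u v ≡ a v u
  s u v with u ≟ v | v ≟ u
  ... | yes _ | yes _ = refl
  ... | yes p | no q = Data.Empty.⊥-elim (q (sym p))
    where import Data.Empty
  ... | no p | yes q = Data.Empty.⊥-elim (p (sym q))
    where import Data.Empty
  ... | no _ | no _ = ∨-comm (e u v) (e v u)
  i : ∀ v → a v v ≡ false
  i v with v ≟ v
  ... | yes _ = refl
  ... | no p = Data.Empty.⊥-elim (p refl)
    where import Data.Empty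

-- The subdivided star with k rays, on vertex set Fin (1 + k + k):
-- vertex 0 is the centre, vertices 1..k are the subdivision vertices,
-- vertex i + k is the leaf attached to vertex i (1 ≤ i ≤ k).
subdividedStar : (k : ℕ) → Graph (suc (k + k))
subdividedStar k = mkGraph λ u v → edge (toℕ u) (toℕ v)
  where
  mid : ℕ → Bool
  mid x = (1 ≤ᵇ x) ∧ (x ≤ᵇ k)
  edge : ℕ → ℕ → Bool
  edge x y = ((x ≡ᵇ 0) ∧ mid y) ∨ (mid x ∧ (y ≡ᵇ (x + k)))

IsSubdividedStar : ∀ {t} → Graph t → Set
IsSubdividedStar {t} T =
  ∃[ k ] Σ (Fin t ⤖ Fin (suc (k + k))) λ φ →
    ∀ u v → adj T u v ≡ adj (subdividedStar k) (Bijection.to φ u) (Bijection.to φ v)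

IsStable : ∀ {n} → Graph n → Subset n → Set
IsStable G S = ∀ u v → u ∈ S → v ∈ S → u ≢ v → adj G u v ≡ false

IsClique : ∀ {n} → Graph n → Subset n → Set
IsClique G S = ∀ u v → u ∈ S → v ∈ S → u ≢ v → adj G u v ≡ true

IsAlpha : ∀ {n} → Graph n → Subset n → ℕ → Set
IsAlpha G X a =
  (∃[ S ] (S ⊆ X × IsStable G S × ∣ S ∣ ≡ a)) ×
  (∀ S → S ⊆ X → IsStable G S → ∣ S ∣ ≤ a)

HasClique : ∀ {n} → Graph n → Subset n → ℕ → Set
HasClique G X s = ∃[ S ] (S ⊆ X × IsClique G S × ∣ S ∣ ≡ s)

HasStable : ∀ {n} → Graph n → Subset n → ℕ → Set
HasStable G X s = ∃[ S ] (S ⊆ X × IsStable G S × ∣ S ∣ ≡ s)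

InducedIn : ∀ {a n} → Graph a → Subset a → Graph n → Subset n → Set
InducedIn {a} {n} H Y G X =
  Σ (Fin a → Fin n) λ φ →
    (∀ u → u ∈ Y → φ u ∈ X) ×
    (∀ u v → u ∈ Y → v ∈ Y → φ u ≡ φ v → u ≡ v) ×
    (∀ u v → u ∈ Y → v ∈ Y → adj G (φ u) (φ v) ≡ adj H u v)

P4 : Graph 4
P4 = mkGraph λ u v → suc (toℕ u) ≡ᵇ toℕ v

P4Free : ∀ {n} → Graph n → Subset n → Set
P4Free G X = ¬ InducedIn P4 ⊤ G X

-- A partition of V(G) into m (labelled) parts is a map f : Fin n → Fin m;
-- part f i is the set X_{i+1} = f⁻¹(i).  Index i with toℕ i ≡ 0 is X_1.
part : ∀ {n m} → (Fin n → Fin m) → Fin m → Subset n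
part f i = tabulate λ v → does (f v ≟ i)

FirstPartMaxAlpha : ∀ {n m} → Graph n → (Fin n → Fin m) → Set
FirstPartMaxAlpha G f =
  ∀ i j a b → toℕ i ≡ 0 → IsAlpha G (part f i) a → IsAlpha G (part f j) b → b ≤ a

Interesting : ∀ {t n m} → Graph t → Graph n → (Fin n → Fin m) → Set
Interesting {t} T G f =
  FirstPartMaxAlpha G f ×
  (∀ i → HasClique G (part f i) t ⊎ HasStable G (part f i) t)

Witnessing : ∀ {t n m} → Graph t → Graph n → (Fin n → Fin m) → Set
Witnessing {t} {n} {m} T G f =
  ∀ (g : Fin t → Fin m) → ∃[ i ] ¬ InducedIn T (part g i) G (part f i)

Certifying : ∀ {t n m} → Graph t → Graph n → (Fin n → Fin m) → Set
Certifying {t} T G f =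
  Witnessing T G f ×
  FirstPartMaxAlpha G f ×
  ((∀ i → toℕ i ≢ 0 → HasClique G (part f i) t) ×
   (∀ i → toℕ i ≡ 0 → HasClique G (part f i) t ⊎ HasStable G (part f i) t)) ×
  (∀ i → P4Free G (part f i))

-- Let k be the number of rays of T.  The centre and the k leaves form a maximum stable set, so
-- α(T) = k + 1 and the partition has k parts X₁, …, X_k.
--
-- If every part is a clique, then in any partition of V(T) into k pieces two of the k + 1
-- spokes (the centre and the leaves) share a piece, which, as they are non-adjacent, does not
-- embed in a clique.  If X₁ is stable and the other parts are cliques, no ray may lie in the
-- piece for X₁, so each ray has a vertex in another piece; two of these k pairwise non-adjacent
-- vertices share one of the k − 1 remaining pieces.  Cliques and stable sets are P₄-free, and a
-- clique part cannot contain a stable set of size |V(T)| ≥ 2, so the partition is certifying.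
--
-- Conversely, a part that contains a homogeneous triple (its big clique or stable set) but is
-- not itself homogeneous contains an induced P₃ or K₂ + K₁.  The centre together with two rays
-- induces a path P₅, which splits into that three-vertex graph and an edge or a non-edge, as
-- found in some other part; every other ray is an edge and goes into its own clique part.  This
-- puts each piece of a partition of T inside the matching part of G, contradicting witnessing.

module Submission where

open import Defs
open import Data.Bool using (Bool; true; false; not; _∧_; _∨_)
import Data.Bool.Properties as Bool
open import Data.Empty using (⊥; ⊥-elim)
import Data.Fin as Fin
open import Data.Fin using (Fin; zero; suc; toℕ; _↑ˡ_; _↑ʳ_; splitAt; inject≤; punchIn)
open import Data.Fin.Patterns using (0F; 1F; 2F; 3F; 4F)
open import Data.Fin.Properties
  using (_≟_; any?; all?; pigeonhole; injective⇒≤; inject≤-injective; suc-injective; toℕ-injective;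
         toℕ<n; toℕ-↑ˡ; toℕ-↑ʳ; splitAt-↑ˡ; splitAt-↑ʳ; join-splitAt; punchInᵢ≢i; <⇒≢)
import Data.Fin.Permutation as Permutation
import Data.Fin.Permutation.Components as PC
open import Data.Fin.Subset using (Subset; _∈_; _⊆_; ∣_∣; ⊤)
open import Data.Fin.Subset.Properties using (_∈?_; ∈⊤)
open import Data.Nat using (ℕ; zero; suc; _+_; _∸_; _≤_; _<_; _≡ᵇ_; _≤ᵇ_; z≤n; s≤s)
import Data.Nat.Properties as ℕ
open import Data.Product using (Σ; ∃; ∃₂; ∃-syntax; _×_; _,_; proj₁; proj₂; uncurry)
open import Data.Sum using (_⊎_; inj₁; inj₂; [_,_]′)
open import Data.Sum.Properties using ([,]-∘)
open import Data.Vec using (Vec; []; _∷_; here; there; tabulate; lookup)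
open import Data.Vec.Properties using (lookup∘tabulate; []=⇒lookup; lookup⇒[]=)
open import Function using (_∘_; id; const)
open import Function.Bundles using (_⇔_; _⤖_; Bijection; Inverse; mk⇔)
open import Function.Definitions using (Injective)
open import Function.Properties.Bijection using (⤖⇒↔)
open import Relation.Nullary using (¬_; Dec; yes; no; does; contradiction)
open import Relation.Nullary.Decidable using (True; toWitness; dec-true; dec-false; _×-dec_; ¬?)
open import Relation.Binary.PropositionalEquality

enumerate : ∀ {n} (S : Subset n) → Fin ∣ S ∣ → Fin n
enumerate (true ∷ S) zero = zero
enumerate (true ∷ S) (suc i) = suc (enumerate S i)
enumerate (false ∷ S) i = suc (enumerate S i)

enumerate-∈ : ∀ {n} (S : Subset n) i → enumerate S i ∈ S
enumerate-∈ (true ∷ S) zero = here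
enumerate-∈ (true ∷ S) (suc i) = there (enumerate-∈ S i)
enumerate-∈ (false ∷ S) i = there (enumerate-∈ S i)

enumerate-injective : ∀ {n} (S : Subset n) → Injective _≡_ _≡_ (enumerate S)
enumerate-injective (true ∷ S) {zero} {zero} _ = refl
enumerate-injective (true ∷ S) {suc i} {suc j} e = cong suc (enumerate-injective S (suc-injective e))
enumerate-injective (false ∷ S) e = enumerate-injective S (suc-injective e)

rank : ∀ {n} (S : Subset n) x → x ∈ S → Fin ∣ S ∣
rank (true ∷ S) zero here = zero
rank (true ∷ S) (suc x) (there x∈) = suc (rank S x x∈)
rank (false ∷ S) (suc x) (there x∈) = rank S x x∈

rank-injective : ∀ {n} (S : Subset n) x y (x∈ : x ∈ S) (y∈ : y ∈ S) →
  rank S x x∈ ≡ rank S y y∈ → x ≡ y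
rank-injective (true ∷ S) zero zero here here _ = refl
rank-injective (true ∷ S) (suc x) (suc y) (there x∈) (there y∈) e =
  cong suc (rank-injective S x y x∈ y∈ (suc-injective e))
rank-injective (false ∷ S) (suc x) (suc y) (there x∈) (there y∈) e =
  cong suc (rank-injective S x y x∈ y∈ e)

injectiveOn⇒∣∣≤ : ∀ {n q} (S : Subset n) (f : Fin n → Fin q) →
  (∀ x y → x ∈ S → y ∈ S → f x ≡ f y → x ≡ y) → ∣ S ∣ ≤ q
injectiveOn⇒∣∣≤ S f f-injective = injective⇒≤ λ e →
  enumerate-injective S (f-injective _ _ (enumerate-∈ S _) (enumerate-∈ S _) e)

injection⇒≤∣∣ : ∀ {n p} (S : Subset n) (e : Fin p → Fin n) →
  (∀ i → e i ∈ S) → Injective _≡_ _≡_ e → p ≤ ∣ S ∣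
injection⇒≤∣∣ S e e-∈ e-injective = injective⇒≤ λ eq →
  e-injective (rank-injective S _ _ (e-∈ _) (e-∈ _) eq)

∈-tabulate⁺ : ∀ {n} {p : Fin n → Bool} {x} → p x ≡ true → x ∈ tabulate p
∈-tabulate⁺ {p = p} {x} px = lookup⇒[]= x (tabulate p) (trans (lookup∘tabulate p x) px)

∈-tabulate⁻ : ∀ {n} {p : Fin n → Bool} {x} → x ∈ tabulate p → p x ≡ true
∈-tabulate⁻ {p = p} {x} x∈ = trans (sym (lookup∘tabulate p x)) ([]=⇒lookup x∈)

module _ {n m} (f : Fin n → Fin m) where

  ∈-part⁺ : ∀ {v i} → f v ≡ i → v ∈ part f i
  ∈-part⁺ {v} {i} e = ∈-tabulate⁺ (dec-true (f v ≟ i) e)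

  ∈-part⁻ : ∀ {v i} → v ∈ part f i → f v ≡ i
  ∈-part⁻ {v} {i} v∈ with f v ≟ i | ∈-tabulate⁻ {p = λ u → does (f u ≟ i)} v∈
  ... | yes e | _ = e
  ... | no _  | ()

transpose-injective : ∀ {n} (i j : Fin n) → Injective _≡_ _≡_ (PC.transpose i j)
transpose-injective i j {x} {y} e = begin
  x                                     ≡⟨ PC.transpose-inverse j i ⟨
  PC.transpose j i (PC.transpose i j x) ≡⟨ cong (PC.transpose j i) e ⟩
  PC.transpose j i (PC.transpose i j y) ≡⟨ PC.transpose-inverse j i ⟩
  y                                     ∎
  where open ≡-Reasoning

adj-mkGraph : ∀ {n} {e : Fin n → Fin n → Bool} {u v} → u ≢ v → adj (mkGraph e) u v ≡ (e u v ∨ e v u)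
adj-mkGraph {u = u} {v} u≢v with u ≟ v
... | yes u≡v = contradiction u≡v u≢v
... | no _    = refl

Uniform : ∀ {n} → Graph n → Bool → Subset n → Set
Uniform G b X = ∀ u v → u ∈ X → v ∈ X → u ≢ v → adj G u v ≡ b

uniform : Bool → (h : ℕ) → Graph h
uniform b h = mkGraph λ _ _ → b

K₂ : Graph 2
K₂ = uniform true 2

2K₁ : Graph 2
2K₁ = uniform false 2

P₃ : Graph 3
P₃ = mkGraph λ u v → suc (toℕ u) ≡ᵇ toℕ v

K₂+K₁ : Graph 3
K₂+K₁ = mkGraph λ u v → (toℕ u ≡ᵇ 0) ∧ (toℕ v ≡ᵇ 1)

P₅ : Graph 5
P₅ = mkGraph λ u v → suc (toℕ u) ≡ᵇ toℕ v

adj-uniform : ∀ {b h} {i j : Fin h} → i ≢ j → adj (uniform b h) i j ≡ b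
adj-uniform {b} i≢j = trans (adj-mkGraph i≢j) (Bool.∨-idem b)

module _ {n} (G : Graph n) where

  induced-by : ∀ {h} {H : Graph h} {X} (w : Fin h → Fin n) → (∀ i → w i ∈ X) →
    (∀ {i j} → i ≢ j → w i ≢ w j) → (∀ {i j} → i ≢ j → adj G (w i) (w j) ≡ adj H i j) →
    InducedIn H ⊤ G X
  induced-by {H = H} w w-∈ w-≢ w-adj = w , (λ i _ → w-∈ i) , w-injective , w-adj′
    where
    w-injective : ∀ i j → i ∈ ⊤ → j ∈ ⊤ → w i ≡ w j → i ≡ j
    w-injective i j _ _ e with i ≟ j
    ... | yes i≡j = i≡j
    ... | no i≢j  = contradiction e (w-≢ i≢j)
    w-adj′ : ∀ i j → i ∈ ⊤ → j ∈ ⊤ → adj G (w i) (w j) ≡ adj H i j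
    w-adj′ i j _ _ with i ≟ j
    ... | yes refl = trans (adj-irr G (w i)) (sym (adj-irr H i))
    ... | no i≢j   = w-adj i≢j

  uniform-induced : ∀ {b h} {K X : Subset n} → Uniform G b K → K ⊆ X → h ≤ ∣ K ∣ →
    InducedIn (uniform b h) ⊤ G X
  uniform-induced {b} {h} {K} K-uniform K⊆X h≤∣K∣ =
    induced-by {H = uniform b h} w (λ i → K⊆X (enumerate-∈ K _)) w-≢ w-adj
    where
    w : Fin h → Fin n
    w i = enumerate K (inject≤ i h≤∣K∣)
    w-≢ : ∀ {i j} → i ≢ j → w i ≢ w j
    w-≢ i≢j e = i≢j (inject≤-injective h≤∣K∣ h≤∣K∣ _ _ (enumerate-injective K e))
    w-adj : ∀ {i j} → i ≢ j → adj G (w i) (w j) ≡ adj (uniform b h) i j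
    w-adj i≢j = trans (K-uniform _ _ (enumerate-∈ K _) (enumerate-∈ K _) (w-≢ i≢j)) (sym (adj-uniform i≢j))

  has-uniform-induced : ∀ {b h s} {X : Subset n} → ∃[ K ] (K ⊆ X × Uniform G b K × ∣ K ∣ ≡ s) →
    h ≤ s → InducedIn (uniform b h) ⊤ G X
  has-uniform-induced (K , K⊆X , K-uniform , refl) = uniform-induced K-uniform K⊆X

  uniform-excludes : ∀ {b a} {H : Graph a} {Y X u v} → Uniform G b X →
    u ∈ Y → v ∈ Y → u ≢ v → adj H u v ≡ not b → ¬ InducedIn H Y G X
  uniform-excludes {b} {H = H} {u = u} {v} X-uniform u∈ v∈ u≢v uv (w , w-∈ , w-injective , w-adj) =
    Bool.not-¬ refl (begin
      b                 ≡⟨ X-uniform _ _ (w-∈ u u∈) (w-∈ v v∈) (u≢v ∘ w-injective u v u∈ v∈) ⟨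
      adj G (w u) (w v) ≡⟨ w-adj u v u∈ v∈ ⟩
      adj H u v         ≡⟨ uv ⟩
      not b             ∎)
    where open ≡-Reasoning

  uniform⇒P4Free : ∀ {b X} → Uniform G b X → P4Free G X
  uniform⇒P4Free {true}  X-clique = uniform-excludes {H = P4} {Y = ⊤} {u = 0F} {2F} X-clique ∈⊤ ∈⊤ (λ ()) refl
  uniform⇒P4Free {false} X-stable = uniform-excludes {H = P4} {Y = ⊤} {u = 0F} {1F} X-stable ∈⊤ ∈⊤ (λ ()) refl

  uniform⇒clique-or-stable : ∀ b {X} → Uniform G b X → IsClique G X ⊎ IsStable G X
  uniform⇒clique-or-stable true  = inj₁
  uniform⇒clique-or-stable false = inj₂

  clique-or-stable⇒uniform : ∀ {X s} → HasClique G X s ⊎ HasStable G X s →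
    ∃ λ b → ∃[ K ] (K ⊆ X × Uniform G b K × ∣ K ∣ ≡ s)
  clique-or-stable⇒uniform = [ (true ,_) , (false ,_) ]′

  uniform-or-violation : ∀ b X →
    Uniform G b X ⊎ ∃₂ λ u v → u ∈ X × v ∈ X × u ≢ v × adj G u v ≡ not b
  uniform-or-violation b X
    with any? (λ u → any? λ v → u ∈? X ×-dec v ∈? X ×-dec ¬? (u ≟ v) ×-dec adj G u v Bool.≟ not b)
  ... | yes (u , v , violation) = inj₂ (u , v , violation)
  ... | no none = inj₁ λ u v u∈ v∈ u≢v →
    trans (Bool.¬-not λ e → none (u , v , u∈ , v∈ , u≢v , e)) (Bool.not-involutive b)

-- Mixed triples

three-avoid-two : ∀ {n} (w : Fin 3 → Fin n) → Injective _≡_ _≡_ w → ∀ u v → ∃ λ i → w i ≢ u × w i ≢ v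
three-avoid-two w w-injective u v with any? (λ i → ¬? (w i ≟ u) ×-dec ¬? (w i ≟ v))
... | yes found = found
... | no none = contradiction (injective⇒≤ side-injective) λ { (s≤s (s≤s ())) }
  where
  hits : ∀ i → w i ≡ u ⊎ w i ≡ v
  hits i with w i ≟ u | w i ≟ v
  ... | yes wi≡u | _        = inj₁ wi≡u
  ... | no _     | yes wi≡v = inj₂ wi≡v
  ... | no wi≢u  | no wi≢v  = contradiction (i , wi≢u , wi≢v) none
  side : Fin 3 → Fin 2
  side i = [ const 0F , const 1F ]′ (hits i)
  side-injective : Injective _≡_ _≡_ side
  side-injective {i} {j} e with hits i | hits j
  ... | inj₁ wi≡u | inj₁ wj≡u = w-injective (trans wi≡u (sym wj≡u))
  ... | inj₂ wi≡v | inj₂ wj≡v = w-injective (trans wi≡v (sym wj≡v))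
  ... | inj₁ _    | inj₂ _    = contradiction e λ ()
  ... | inj₂ _    | inj₁ _    = contradiction e λ ()

record MixedTriple {n} (G : Graph n) (X : Subset n) : Set where
  field
    p q r : Fin n
    p∈ : p ∈ X
    q∈ : q ∈ X
    r∈ : r ∈ X
    p≢q : p ≢ q
    p≢r : p ≢ r
    q≢r : q ≢ r
    adj-pq : adj G p q ≡ true
    adj-pr : adj G p r ≡ false

module _ {n} (G : Graph n) {X : Subset n} where

  mixed-at : ∀ {p q r} → p ∈ X → q ∈ X → r ∈ X → p ≢ q → p ≢ r → q ≢ r →
    adj G p q ≢ adj G p r → MixedTriple G X
  mixed-at {p} {q} {r} p∈ q∈ r∈ p≢q p≢r q≢r differ with adj G p q Bool.≟ true
  ... | yes pq = record
    { p = p ; q = q ; r = r ; p∈ = p∈ ; q∈ = q∈ ; r∈ = r∈ ; p≢q = p≢q ; p≢r = p≢r ; q≢r = q≢r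
    ; adj-pq = pq ; adj-pr = Bool.¬-not λ pr → differ (trans pq (sym pr)) }
  ... | no pq = record
    { p = p ; q = r ; r = q ; p∈ = p∈ ; q∈ = r∈ ; r∈ = q∈ ; p≢q = p≢r ; p≢r = p≢q ; q≢r = ≢-sym q≢r
    ; adj-pq = Bool.¬-not λ pr → differ (trans (Bool.¬-not pq) (sym pr)) ; adj-pr = Bool.¬-not pq }

  -- Take w i of the b-uniform triple outside the violating pair {u, v}.  If w i – u has type b,
  -- then u sees w i and v differently; otherwise w i sees another w j and u differently.
  uniform-or-mixed : ∀ {b} → InducedIn (uniform b 3) ⊤ G X → Uniform G b X ⊎ MixedTriple G X
  uniform-or-mixed {b} (w , w-∈ , w-inj , w-adj) with uniform-or-violation G b X
  ... | inj₁ X-uniform = inj₁ X-uniform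
  ... | inj₂ (u , v , u∈ , v∈ , u≢v , uv) with three-avoid-two w (w-inj _ _ ∈⊤ ∈⊤) u v
  ...   | i , wi≢u , wi≢v = inj₂ (mixed (adj G (w i) u Bool.≟ b))
    where
    j : Fin 3
    j = punchIn i 0F
    j≢i : j ≢ i
    j≢i = punchInᵢ≢i i 0F
    wi-wj : adj G (w i) (w j) ≡ b
    wi-wj = trans (w-adj i j ∈⊤ ∈⊤) (adj-uniform (≢-sym j≢i))
    mixed : Dec (adj G (w i) u ≡ b) → MixedTriple G X
    mixed (yes wi-u) = mixed-at u∈ (w-∈ i ∈⊤) v∈ (≢-sym wi≢u) u≢v wi≢v λ e →
      Bool.not-¬ refl (trans (sym wi-u) (trans (adj-sym G (w i) u) (trans e uv)))
    mixed (no wi-u≢b) = mixed-at (w-∈ i ∈⊤) (w-∈ j ∈⊤) u∈ (j≢i ∘ sym ∘ w-inj _ _ ∈⊤ ∈⊤) wi≢u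
      (λ wj≡u → wi-u≢b (trans (cong (adj G (w i)) (sym wj≡u)) wi-wj))
      (λ e → wi-u≢b (trans (sym e) wi-wj))

  triple-induced : ∀ (H : Graph 3) {p q r} → p ∈ X → q ∈ X → r ∈ X → p ≢ q → p ≢ r → q ≢ r →
    adj G p q ≡ adj H 0F 1F → adj G p r ≡ adj H 0F 2F → adj G q r ≡ adj H 1F 2F → InducedIn H ⊤ G X
  triple-induced H {p} {q} {r} p∈ q∈ r∈ p≢q p≢r q≢r pq pr qr = induced-by G {H = H} w w-∈ w-≢ w-adj
    where
    w : Fin 3 → Fin n
    w 0F = p
    w 1F = q
    w 2F = r
    w-∈ : ∀ i → w i ∈ X
    w-∈ 0F = p∈
    w-∈ 1F = q∈
    w-∈ 2F = r∈
    w-≢ : ∀ {i j} → i ≢ j → w i ≢ w j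
    w-≢ {0F} {0F} i≢j = contradiction refl i≢j
    w-≢ {0F} {1F} _ = p≢q
    w-≢ {0F} {2F} _ = p≢r
    w-≢ {1F} {0F} _ = ≢-sym p≢q
    w-≢ {1F} {1F} i≢j = contradiction refl i≢j
    w-≢ {1F} {2F} _ = q≢r
    w-≢ {2F} {0F} _ = ≢-sym p≢r
    w-≢ {2F} {1F} _ = ≢-sym q≢r
    w-≢ {2F} {2F} i≢j = contradiction refl i≢j
    w-adj : ∀ {i j} → i ≢ j → adj G (w i) (w j) ≡ adj H i j
    w-adj {0F} {0F} i≢j = contradiction refl i≢j
    w-adj {0F} {1F} _ = pq
    w-adj {0F} {2F} _ = pr
    w-adj {1F} {0F} _ = trans (adj-sym G q p) (trans pq (adj-sym H 0F 1F))
    w-adj {1F} {1F} i≢j = contradiction refl i≢j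
    w-adj {1F} {2F} _ = qr
    w-adj {2F} {0F} _ = trans (adj-sym G r p) (trans pr (adj-sym H 0F 2F))
    w-adj {2F} {1F} _ = trans (adj-sym G r q) (trans qr (adj-sym H 1F 2F))
    w-adj {2F} {2F} i≢j = contradiction refl i≢j

  mixed-induced : MixedTriple G X → InducedIn P₃ ⊤ G X ⊎ InducedIn K₂+K₁ ⊤ G X
  mixed-induced m = classify (adj G q r Bool.≟ true)
    where
    open MixedTriple m
    classify : Dec (adj G q r ≡ true) → InducedIn P₃ ⊤ G X ⊎ InducedIn K₂+K₁ ⊤ G X
    classify (yes qr) = inj₁ (triple-induced P₃ p∈ q∈ r∈ p≢q p≢r q≢r adj-pq adj-pr qr)
    classify (no qr)  = inj₂ (triple-induced K₂+K₁ p∈ q∈ r∈ p≢q p≢r q≢r adj-pq adj-pr (Bool.¬-not qr))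

-- Tilings

-- T is the disjoint union of induced copies of the graphs H j; edges between copies are arbitrary.
record Tiling {t} (T : Graph t) {m} {h : Fin m → ℕ} (H : ∀ j → Graph (h j)) : Set where
  field
    locate       : Fin t → Σ (Fin m) (λ j → Fin (h j))
    place        : ∀ j → Fin (h j) → Fin t
    place-locate : ∀ u → uncurry place (locate u) ≡ u
    place-adj    : ∀ j a b → adj T (place j a) (place j b) ≡ adj (H j) a b

  tile : Fin t → Fin m
  tile = proj₁ ∘ locate

tiling-induced : ∀ {t n m m′} {T : Graph t} {G : Graph n} {h : Fin m → ℕ} {H : ∀ j → Graph (h j)}
  (τ : Tiling T H) {X : Fin m′ → Subset n} {σ : Fin m → Fin m′} → Injective _≡_ _≡_ σ →
  (∀ j → InducedIn (H j) ⊤ G (X (σ j))) → ∀ i → InducedIn T (part (σ ∘ Tiling.tile τ) i) G (X i)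
tiling-induced {t} {n} {m} {T = T} {G} {h} τ {X} {σ} σ-injective embed i =
  φ , φ-∈ , φ-injective , φ-adj
  where
  open Tiling τ
  ε : Σ (Fin m) (λ j → Fin (h j)) → Fin n
  ε (j , a) = proj₁ (embed j) a
  ε-∈ : ∀ x → ε x ∈ X (σ (proj₁ x))
  ε-∈ (j , a) with embed j
  ... | _ , ψ-∈ , _ = ψ-∈ a ∈⊤
  within-tile : ∀ x y → proj₁ x ≡ proj₁ y →
    (ε x ≡ ε y → x ≡ y) × adj G (ε x) (ε y) ≡ adj T (uncurry place x) (uncurry place y)
  within-tile (j , a) (.j , b) refl with embed j
  ... | _ , _ , ψ-injective , ψ-adj =
    (λ e → cong (j ,_) (ψ-injective a b ∈⊤ ∈⊤ e)) , trans (ψ-adj a b ∈⊤ ∈⊤) (sym (place-adj j a b))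
  φ : Fin t → Fin n
  φ = ε ∘ locate
  Y : Subset t
  Y = part (σ ∘ tile) i
  same-tile : ∀ {u v} → u ∈ Y → v ∈ Y → tile u ≡ tile v
  same-tile u∈ v∈ = σ-injective (trans (∈-part⁻ (σ ∘ tile) u∈) (sym (∈-part⁻ (σ ∘ tile) v∈)))
  φ-∈ : ∀ u → u ∈ Y → φ u ∈ X i
  φ-∈ u u∈ = subst (λ j → φ u ∈ X j) (∈-part⁻ (σ ∘ tile) u∈) (ε-∈ (locate u))
  φ-injective : ∀ u v → u ∈ Y → v ∈ Y → φ u ≡ φ v → u ≡ v
  φ-injective u v u∈ v∈ e = begin
    u                        ≡⟨ place-locate u ⟨
    uncurry place (locate u) ≡⟨ cong (uncurry place) (proj₁ (within-tile _ _ (same-tile u∈ v∈)) e) ⟩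
    uncurry place (locate v) ≡⟨ place-locate v ⟩
    v                        ∎
    where open ≡-Reasoning
  φ-adj : ∀ u v → u ∈ Y → v ∈ Y → adj G (φ u) (φ v) ≡ adj T u v
  φ-adj u v u∈ v∈ = trans (proj₂ (within-tile _ _ (same-tile u∈ v∈)))
                          (cong₂ (adj T) (place-locate u) (place-locate v))

-- The subdivided star

data StarVertex (k : ℕ) : Set where
  centre : StarVertex k
  mid leaf : Fin k → StarVertex k

module _ {k : ℕ} where

  arc : StarVertex k → StarVertex k → Bool
  arc centre (mid _) = true
  arc (mid r) (leaf s) = does (r ≟ s)
  arc _ _ = false

  starAdj : StarVertex k → StarVertex k → Bool
  starAdj a b = arc a b ∨ arc b a

  starAdj-irrefl : ∀ a → starAdj a a ≡ false
  starAdj-irrefl centre = refl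
  starAdj-irrefl (mid _) = refl
  starAdj-irrefl (leaf _) = refl

  spoke : Fin (suc k) → StarVertex k
  spoke 0F = centre
  spoke (suc r) = leaf r

  spoke-injective : Injective _≡_ _≡_ spoke
  spoke-injective {0F} {0F} _ = refl
  spoke-injective {suc r} {suc s} refl = refl

  isSpoke : StarVertex k → Bool
  isSpoke (mid _) = false
  isSpoke _ = true

  isSpoke-spoke : ∀ i → isSpoke (spoke i) ≡ true
  isSpoke-spoke 0F = refl
  isSpoke-spoke (suc _) = refl

  spokes-nonadjacent : ∀ {a b} → isSpoke a ≡ true → isSpoke b ≡ true → starAdj a b ≡ false
  spokes-nonadjacent {centre} {centre} _ _ = refl
  spokes-nonadjacent {centre} {leaf _} _ _ = refl
  spokes-nonadjacent {leaf _} {centre} _ _ = refl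
  spokes-nonadjacent {leaf _} {leaf _} _ _ = refl
  spokes-nonadjacent {mid _} () _
  spokes-nonadjacent {centre} {mid _} _ ()
  spokes-nonadjacent {leaf _} {mid _} _ ()

  rayIndex : StarVertex k → Fin (suc k)
  rayIndex centre = 0F
  rayIndex (mid r) = suc r
  rayIndex (leaf r) = suc r

  same-ray-adjacent : ∀ a b → rayIndex a ≡ rayIndex b → a ≢ b → starAdj a b ≡ true
  same-ray-adjacent centre centre _ a≢b = contradiction refl a≢b
  same-ray-adjacent (mid r) (mid s) e a≢b = contradiction (cong mid (suc-injective e)) a≢b
  same-ray-adjacent (mid r) (leaf s) e _ = cong (_∨ false) (dec-true (r ≟ s) (suc-injective e))
  same-ray-adjacent (leaf r) (mid s) e _ = dec-true (s ≟ r) (sym (suc-injective e))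
  same-ray-adjacent (leaf r) (leaf s) e a≢b = contradiction (cong leaf (suc-injective e)) a≢b

  ray : Fin k → Fin 2 → StarVertex k
  ray r 0F = mid r
  ray r 1F = leaf r

  ray-adj : ∀ r a b → starAdj (ray r a) (ray r b) ≡ adj K₂ a b
  ray-adj r 0F 0F = refl
  ray-adj r 0F 1F = cong (_∨ false) (dec-true (r ≟ r) refl)
  ray-adj r 1F 0F = dec-true (r ≟ r) refl
  ray-adj r 1F 1F = refl

  rays-apart : ∀ {r s} → r ≢ s → ∀ a b → starAdj (ray r a) (ray s b) ≡ false
  rays-apart r≢s 0F 0F = refl
  rays-apart {r} {s} r≢s 0F 1F = cong (_∨ false) (dec-false (r ≟ s) r≢s)
  rays-apart {r} {s} r≢s 1F 0F = dec-false (s ≟ r) (≢-sym r≢s)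
  rays-apart r≢s 1F 1F = refl

  rays-distinct : ∀ {r s} → r ≢ s → ∀ a b → ray r a ≢ ray s b
  rays-distinct r≢s 0F 0F refl = r≢s refl
  rays-distinct r≢s 0F 1F ()
  rays-distinct r≢s 1F 0F ()
  rays-distinct r≢s 1F 1F refl = r≢s refl

module StarEncoding (k : ℕ) where

  encode : StarVertex k → Fin (suc (k + k))
  encode centre = 0F
  encode (mid r) = suc (r ↑ˡ k)
  encode (leaf r) = suc (k ↑ʳ r)

  decode : Fin (suc (k + k)) → StarVertex k
  decode 0F = centre
  decode (suc x) = [ mid , leaf ]′ (splitAt k x)

  decode-encode : ∀ a → decode (encode a) ≡ a
  decode-encode centre = refl
  decode-encode (mid r) = cong [ mid , leaf ]′ (splitAt-↑ˡ k r k)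
  decode-encode (leaf r) = cong [ mid , leaf ]′ (splitAt-↑ʳ k k r)

  encode-decode : ∀ x → encode (decode x) ≡ x
  encode-decode 0F = refl
  encode-decode (suc x) = begin
    encode ([ mid , leaf ]′ (splitAt k x))           ≡⟨ [,]-∘ encode (splitAt k x) ⟩
    [ suc ∘ (_↑ˡ k) , suc ∘ (k ↑ʳ_) ]′ (splitAt k x) ≡⟨ [,]-∘ suc (splitAt k x) ⟨
    suc ([ _↑ˡ k , k ↑ʳ_ ]′ (splitAt k x))           ≡⟨ cong suc (join-splitAt k k x) ⟩
    suc x                                            ∎
    where open ≡-Reasoning

  encode-injective : Injective _≡_ _≡_ encode
  encode-injective {a} {b} e = trans (sym (decode-encode a)) (trans (cong decode e) (decode-encode b))

  -- Verbatim copies of the local functions of subdividedStar, hence definitionally equal to them.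
  isMidℕ : ℕ → Bool
  isMidℕ x = (1 ≤ᵇ x) ∧ (x ≤ᵇ k)

  edgeℕ : ℕ → ℕ → Bool
  edgeℕ x y = ((x ≡ᵇ 0) ∧ isMidℕ y) ∨ (isMidℕ x ∧ (y ≡ᵇ (x + k)))

  -- The dec-true/dec-false proofs below rely on does (x ℕ.<? y) and does (x ℕ.≟ y) unfolding
  -- to x <ᵇ y and x ≡ᵇ y.
  isMid-mid : ∀ r → isMidℕ (toℕ (encode (mid r))) ≡ true
  isMid-mid r rewrite toℕ-↑ˡ r k = dec-true (toℕ r ℕ.<? k) (toℕ<n r)

  isMid-leaf : ∀ r → isMidℕ (toℕ (encode (leaf r))) ≡ false
  isMid-leaf r rewrite toℕ-↑ʳ k r = dec-false (k + toℕ r ℕ.<? k) (ℕ.m+n≮m k (toℕ r))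

  edge-from-mid : ∀ r y → edgeℕ (toℕ (encode (mid r))) y ≡ (y ≡ᵇ toℕ (encode (mid r)) + k)
  edge-from-mid r y = cong (λ b → b ∧ (y ≡ᵇ toℕ (encode (mid r)) + k)) (isMid-mid r)

  edge-from-leaf : ∀ r y → edgeℕ (toℕ (encode (leaf r))) y ≡ false
  edge-from-leaf r y = cong (λ b → b ∧ (y ≡ᵇ toℕ (encode (leaf r)) + k)) (isMid-leaf r)

  leaf-offset : ∀ (s : Fin k) → toℕ (k ↑ʳ s) ≡ toℕ s + k
  leaf-offset s = trans (toℕ-↑ʳ k s) (ℕ.+-comm k (toℕ s))

  mid-offset : ∀ (r : Fin k) → toℕ (r ↑ˡ k) + k ≡ toℕ r + k
  mid-offset r = cong (_+ k) (toℕ-↑ˡ r k)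

  edge-arc : ∀ a b → edgeℕ (toℕ (encode a)) (toℕ (encode b)) ≡ arc a b
  edge-arc centre centre = refl
  edge-arc centre (mid s) = cong (_∨ false) (isMid-mid s)
  edge-arc centre (leaf s) = cong (_∨ false) (isMid-leaf s)
  edge-arc (mid r) centre = edge-from-mid r 0
  edge-arc (mid r) (mid s) = trans (edge-from-mid r (toℕ (encode (mid s)))) (dec-false (_ ℕ.≟ _) apart)
    where
    apart : toℕ (s ↑ˡ k) ≢ toℕ (r ↑ˡ k) + k
    apart e = ℕ.<⇒≱ (subst (_< k) (sym (toℕ-↑ˡ s k)) (toℕ<n s)) (subst (k ≤_) (sym e) (ℕ.m≤n+m k _))
  edge-arc (mid r) (leaf s) = trans (edge-from-mid r (toℕ (encode (leaf s)))) (same-ray (r ≟ s))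
    where
    same-ray : (d : Dec (r ≡ s)) → (toℕ (k ↑ʳ s) ≡ᵇ toℕ (r ↑ˡ k) + k) ≡ does d
    same-ray (yes refl) = dec-true (_ ℕ.≟ _) (trans (leaf-offset r) (sym (mid-offset r)))
    same-ray (no r≢s) = dec-false (_ ℕ.≟ _) λ e → r≢s (toℕ-injective (ℕ.+-cancelʳ-≡ k _ _
      (trans (sym (mid-offset r)) (trans (sym e) (leaf-offset s)))))
  edge-arc (leaf r) b = edge-from-leaf r (toℕ (encode b))

  adj-encode : ∀ a b → adj (subdividedStar k) (encode a) (encode b) ≡ starAdj a b
  adj-encode a b = by-cases (encode a ≟ encode b)
    where
    by-cases : Dec (encode a ≡ encode b) → adj (subdividedStar k) (encode a) (encode b) ≡ starAdj a b
    by-cases (yes e) = subst (λ c → adj (subdividedStar k) (encode a) (encode c) ≡ starAdj a c)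
      (encode-injective e) (trans (adj-irr (subdividedStar k) (encode a)) (sym (starAdj-irrefl a)))
    by-cases (no a≢b) = trans (adj-mkGraph a≢b) (cong₂ _∨_ (edge-arc a b) (edge-arc b a))

module StarShaped {t} (T : Graph t) (k : ℕ) (φ : Fin t ⤖ Fin (suc (k + k)))
  (iso : ∀ u v → adj T u v ≡ adj (subdividedStar k) (Bijection.to φ u) (Bijection.to φ v)) where

  open StarEncoding k
  open Inverse (⤖⇒↔ φ) using (to; from; strictlyInverseˡ; strictlyInverseʳ)

  vertex : Fin t → StarVertex k
  vertex = decode ∘ to

  vertex⁻¹ : StarVertex k → Fin t
  vertex⁻¹ = from ∘ encode

  vertex⁻¹-vertex : ∀ u → vertex⁻¹ (vertex u) ≡ u
  vertex⁻¹-vertex u = trans (cong from (encode-decode (to u))) (strictlyInverseʳ u)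

  vertex-vertex⁻¹ : ∀ a → vertex (vertex⁻¹ a) ≡ a
  vertex-vertex⁻¹ a = trans (cong decode (strictlyInverseˡ (encode a))) (decode-encode a)

  vertex-injective : Injective _≡_ _≡_ vertex
  vertex-injective {u} {v} e = trans (sym (vertex⁻¹-vertex u)) (trans (cong vertex⁻¹ e) (vertex⁻¹-vertex v))

  vertex⁻¹-injective : Injective _≡_ _≡_ vertex⁻¹
  vertex⁻¹-injective {a} {b} e = trans (sym (vertex-vertex⁻¹ a)) (trans (cong vertex e) (vertex-vertex⁻¹ b))

  adj-vertex⁻¹ : ∀ a b → adj T (vertex⁻¹ a) (vertex⁻¹ b) ≡ starAdj a b
  adj-vertex⁻¹ a b = begin
    adj T (vertex⁻¹ a) (vertex⁻¹ b)                            ≡⟨ iso _ _ ⟩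
    adj (subdividedStar k) (to (vertex⁻¹ a)) (to (vertex⁻¹ b)) ≡⟨ cong₂ (adj (subdividedStar k))
                                                                    (strictlyInverseˡ (encode a))
                                                                    (strictlyInverseˡ (encode b)) ⟩
    adj (subdividedStar k) (encode a) (encode b)               ≡⟨ adj-encode a b ⟩
    starAdj a b                                                ∎
    where open ≡-Reasoning

  adj-vertex : ∀ u v → adj T u v ≡ starAdj (vertex u) (vertex v)
  adj-vertex u v = trans (cong₂ (adj T) (sym (vertex⁻¹-vertex u)) (sym (vertex⁻¹-vertex v))) (adj-vertex⁻¹ _ _)

  order : t ≡ suc (k + k)
  order = Permutation.↔⇒≡ (⤖⇒↔ φ)

  α-star : ∀ a → IsAlpha T ⊤ a → a ≡ suc k
  α-star _ ((S , _ , S-stable , refl) , maximal) = ℕ.≤-antisym at-most at-least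
    where
    one-per-ray : ∀ u v → u ∈ S → v ∈ S → rayIndex (vertex u) ≡ rayIndex (vertex v) → u ≡ v
    one-per-ray u v u∈ v∈ same with u ≟ v
    ... | yes u≡v = u≡v
    ... | no u≢v = contradiction (begin
      true                          ≡⟨ same-ray-adjacent _ _ same (u≢v ∘ vertex-injective) ⟨
      starAdj (vertex u) (vertex v) ≡⟨ adj-vertex u v ⟨
      adj T u v                     ≡⟨ S-stable u v u∈ v∈ u≢v ⟩
      false                         ∎) λ ()
      where open ≡-Reasoning
    at-most : ∣ S ∣ ≤ suc k
    at-most = injectiveOn⇒∣∣≤ S (rayIndex ∘ vertex) one-per-ray
    spokes : Subset t
    spokes = tabulate (isSpoke ∘ vertex)
    spokes-stable : IsStable T spokes
    spokes-stable u v u∈ v∈ _ = trans (adj-vertex u v) (spokes-nonadjacent (∈-tabulate⁻ u∈) (∈-tabulate⁻ v∈))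
    spoke-∈ : ∀ i → vertex⁻¹ (spoke i) ∈ spokes
    spoke-∈ i = ∈-tabulate⁺ (trans (cong isSpoke (vertex-vertex⁻¹ (spoke i))) (isSpoke-spoke i))
    at-least : suc k ≤ ∣ S ∣
    at-least = ℕ.≤-trans (injection⇒≤∣∣ spokes (vertex⁻¹ ∘ spoke) spoke-∈ (spoke-injective ∘ vertex⁻¹-injective))
                         (maximal spokes (λ _ → ∈⊤) spokes-stable)

  module _ {n} {G : Graph n} (f : Fin n → Fin k) where

    clique-parts-witness : (∀ j → IsClique G (part f j)) → Witnessing T G f
    clique-parts-witness cliques g with pigeonhole (ℕ.n<1+n k) (g ∘ vertex⁻¹ ∘ spoke)
    ... | i , j , i<j , same = g (vertex⁻¹ (spoke i)) ,
      uniform-excludes G {H = T} (cliques _) (∈-part⁺ g refl) (∈-part⁺ g (sym same))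
        (<⇒≢ i<j ∘ spoke-injective ∘ vertex⁻¹-injective)
        (trans (adj-vertex⁻¹ _ _) (spokes-nonadjacent (isSpoke-spoke i) (isSpoke-spoke j)))

    -- Each ray has a vertex z r outside part i₀, or an edge of T lies in the stable part.  The
    -- k parts of the z r together with i₀ itself are k + 1 pigeons in k holes.
    stable-part-witness : ∀ i₀ → IsStable G (part f i₀) → (∀ j → j ≢ i₀ → IsClique G (part f j)) →
      Witnessing T G f
    stable-part-witness i₀ stable cliques g
      with any? (λ r → g (vertex⁻¹ (ray r 0F)) ≟ i₀ ×-dec g (vertex⁻¹ (ray r 1F)) ≟ i₀)
    ... | yes (r , mid∈ , leaf∈) = i₀ ,
      uniform-excludes G {H = T} stable (∈-part⁺ g mid∈) (∈-part⁺ g leaf∈)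
        ((λ ()) ∘ vertex⁻¹-injective {ray r 0F} {ray r 1F})
        (trans (adj-vertex⁻¹ (ray r 0F) (ray r 1F)) (ray-adj r 0F 1F))
    ... | no none = collide (pigeonhole (ℕ.n<1+n k) slot)
      where
      avoid : ∀ r → ∃ λ a → g (vertex⁻¹ (ray r a)) ≢ i₀
      avoid r with g (vertex⁻¹ (ray r 0F)) ≟ i₀
      ... | no mid∉ = 0F , mid∉
      ... | yes mid∈ = 1F , λ leaf∈ → none (r , mid∈ , leaf∈)
      z : Fin k → Fin t
      z r = vertex⁻¹ (ray r (proj₁ (avoid r)))
      slot : Fin (suc k) → Fin k
      slot 0F = i₀
      slot (suc r) = g (z r)
      collide : (∃₂ λ i j → i Fin.< j × slot i ≡ slot j) → ∃ λ ℓ → ¬ InducedIn T (part g ℓ) G (part f ℓ)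
      collide (0F , suc s , _ , e) = contradiction (sym e) (proj₂ (avoid s))
      collide (suc r , suc s , r<s , e) = g (z r) ,
        uniform-excludes G {H = T} (cliques _ (proj₂ (avoid r))) (∈-part⁺ g refl) (∈-part⁺ g (sym e))
          (rays-distinct r≢s _ _ ∘ vertex⁻¹-injective)
          (trans (adj-vertex⁻¹ _ _) (rays-apart r≢s (proj₁ (avoid r)) (proj₁ (avoid s))))
        where
        r≢s : r ≢ s
        r≢s = <⇒≢ r<s ∘ cong suc

-- Splitting P₅ into a pair and a triple

size₂₃ : Fin 2 → ℕ
size₂₃ 0F = 2
size₂₃ 1F = 3

⟨_,_⟩ : Graph 2 → Graph 3 → ∀ j → Graph (size₂₃ j)
⟨ B , A ⟩ 0F = B
⟨ B , A ⟩ 1F = A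

placement : Vec (Fin 5) 2 → Vec (Fin 5) 3 → ∀ j → Fin (size₂₃ j) → Fin 5
placement pair triple 0F = lookup pair
placement pair triple 1F = lookup triple

-- The default (0F , 0F) is never reached: tiling₅ checks that every position is placed.
preimage : (∀ j → Fin (size₂₃ j) → Fin 5) → Fin 5 → Σ (Fin 2) (λ j → Fin (size₂₃ j))
preimage pl p with any? (λ j → any? (λ a → pl j a ≟ p))
... | yes (j , a , _) = j , a
... | no _ = 0F , 0F

tiling₅ : ∀ {B A} (pl : ∀ j → Fin (size₂₃ j) → Fin 5) →
  {_ : True (all? λ p → uncurry pl (preimage pl p) ≟ p)} →
  {_ : True (all? λ j → all? λ a → all? λ b → adj P₅ (pl j a) (pl j b) Bool.≟ adj (⟨ B , A ⟩ j) a b)} →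
  Tiling P₅ ⟨ B , A ⟩
tiling₅ pl {covers} {adjacencies} = record
  { locate = preimage pl ; place = pl ; place-locate = toWitness covers ; place-adj = toWitness adjacencies }

P₃∣K₂ : Tiling P₅ ⟨ K₂ , P₃ ⟩
P₃∣K₂ = tiling₅ (placement (3F ∷ 4F ∷ []) (0F ∷ 1F ∷ 2F ∷ []))

P₃∣2K₁ : Tiling P₅ ⟨ 2K₁ , P₃ ⟩
P₃∣2K₁ = tiling₅ (placement (0F ∷ 4F ∷ []) (1F ∷ 2F ∷ 3F ∷ []))

K₂+K₁∣K₂ : Tiling P₅ ⟨ K₂ , K₂+K₁ ⟩
K₂+K₁∣K₂ = tiling₅ (placement (2F ∷ 3F ∷ []) (0F ∷ 1F ∷ 4F ∷ []))

K₂+K₁∣2K₁ : Tiling P₅ ⟨ 2K₁ , K₂+K₁ ⟩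
K₂+K₁∣2K₁ = tiling₅ (placement (0F ∷ 3F ∷ []) (1F ∷ 2F ∷ 4F ∷ []))

UniformParts : ∀ {n m} → Graph n → (Fin n → Fin m) → Set
UniformParts G f =
  (∀ i → toℕ i ≢ 0 → IsClique G (part f i)) ×
  (∀ i → toℕ i ≡ 0 → IsClique G (part f i) ⊎ IsStable G (part f i))

module Characterisation {t} (T : Graph t) (m : ℕ) (φ : Fin t ⤖ Fin (suc (suc (suc m) + suc (suc m))))
  (iso : ∀ u v → adj T u v ≡ adj (subdividedStar (suc (suc m))) (Bijection.to φ u) (Bijection.to φ v)) where

  open StarShaped T (suc (suc m)) φ iso

  core : Fin 5 → StarVertex (suc (suc m))
  core 0F = leaf 0F
  core 1F = mid 0F
  core 2F = centre
  core 3F = mid 1F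
  core 4F = leaf 1F

  core-adj : ∀ p q → starAdj (core p) (core q) ≡ adj P₅ p q
  core-adj = toWitness {a? = all? λ p → all? λ q → starAdj (core p) (core q) Bool.≟ adj P₅ p q} _

  module _ {h : Fin 2 → ℕ} {H : ∀ j → Graph (h j)} (τ : Tiling P₅ H) where

    open Tiling τ renaming (locate to locate₅; place to place₅; place-locate to place-locate₅; place-adj to place-adj₅)

    size : Fin (suc (suc m)) → ℕ
    size 0F = h 0F
    size 1F = h 1F
    size (suc (suc _)) = 2

    piece : ∀ j → Graph (size j)
    piece 0F = H 0F
    piece 1F = H 1F
    piece (suc (suc _)) = K₂

    lift : Σ (Fin 2) (λ j → Fin (h j)) → Σ (Fin (suc (suc m))) (λ j → Fin (size j))
    lift (0F , a) = 0F , a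
    lift (1F , a) = 1F , a

    locateV : StarVertex (suc (suc m)) → Σ (Fin (suc (suc m))) (λ j → Fin (size j))
    locateV centre = lift (locate₅ 2F)
    locateV (mid 0F) = lift (locate₅ 1F)
    locateV (leaf 0F) = lift (locate₅ 0F)
    locateV (mid 1F) = lift (locate₅ 3F)
    locateV (leaf 1F) = lift (locate₅ 4F)
    locateV (mid r@(suc (suc _))) = r , 0F
    locateV (leaf r@(suc (suc _))) = r , 1F

    placeV : ∀ j → Fin (size j) → StarVertex (suc (suc m))
    placeV 0F a = core (place₅ 0F a)
    placeV 1F a = core (place₅ 1F a)
    placeV r@(suc (suc _)) a = ray r a

    placeV-lift : ∀ p → uncurry placeV (lift (locate₅ p)) ≡ core p
    placeV-lift p = trans (by-piece (locate₅ p)) (cong core (place-locate₅ p))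
      where
      by-piece : ∀ x → uncurry placeV (lift x) ≡ core (uncurry place₅ x)
      by-piece (0F , a) = refl
      by-piece (1F , a) = refl

    placeV-locateV : ∀ a → uncurry placeV (locateV a) ≡ a
    placeV-locateV centre = placeV-lift 2F
    placeV-locateV (mid 0F) = placeV-lift 1F
    placeV-locateV (leaf 0F) = placeV-lift 0F
    placeV-locateV (mid 1F) = placeV-lift 3F
    placeV-locateV (leaf 1F) = placeV-lift 4F
    placeV-locateV (mid (suc (suc _))) = refl
    placeV-locateV (leaf (suc (suc _))) = refl

    placeV-adj : ∀ j a b → starAdj (placeV j a) (placeV j b) ≡ adj (piece j) a b
    placeV-adj 0F a b = trans (core-adj (place₅ 0F a) (place₅ 0F b)) (place-adj₅ 0F a b)
    placeV-adj 1F a b = trans (core-adj (place₅ 1F a) (place₅ 1F b)) (place-adj₅ 1F a b)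
    placeV-adj r@(suc (suc _)) a b = ray-adj r a b

    star-tiling : Tiling T piece
    star-tiling = record
      { locate = locateV ∘ vertex
      ; place = λ j a → vertex⁻¹ (placeV j a)
      ; place-locate = λ u → trans (cong vertex⁻¹ (placeV-locateV (vertex u))) (vertex⁻¹-vertex u)
      ; place-adj = λ j a b → trans (adj-vertex⁻¹ _ _) (placeV-adj j a b)
      }

  3≤t : 3 ≤ t
  3≤t = subst (3 ≤_) (sym order) (s≤s (s≤s (s≤s z≤n)))

  2≤t : 2 ≤ t
  2≤t = ℕ.≤-trans (ℕ.n≤1+n 2) 3≤t

  module _ {n} {G : Graph n} (f : Fin n → Fin (suc (suc m))) (witnessing : Witnessing T G f) where

    refute-split : ∀ {B A} (σ : Fin (suc (suc m)) → Fin (suc (suc m))) → Injective _≡_ _≡_ σ →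
      (∀ s → InducedIn K₂ ⊤ G (part f (σ (suc (suc s))))) → Tiling P₅ ⟨ B , A ⟩ →
      InducedIn B ⊤ G (part f (σ 0F)) → InducedIn A ⊤ G (part f (σ 1F)) → ⊥
    refute-split σ σ-injective rays τ pair triple =
      proj₂ refutation (tiling-induced {G = G} (star-tiling τ) {X = part f} σ-injective embed (proj₁ refutation))
      where
      refutation : ∃ λ i → ¬ InducedIn T (part (σ ∘ Tiling.tile (star-tiling τ)) i) G (part f i)
      refutation = witnessing (σ ∘ Tiling.tile (star-tiling τ))
      embed : ∀ j → InducedIn (piece τ j) ⊤ G (part f (σ j))
      embed 0F = pair
      embed 1F = triple
      embed (suc (suc s)) = rays s

    no-mixed-layout : ∀ {γ} (σ : Fin (suc (suc m)) → Fin (suc (suc m))) → Injective _≡_ _≡_ σ →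
      (∀ s → InducedIn K₂ ⊤ G (part f (σ (suc (suc s))))) → InducedIn (uniform γ 2) ⊤ G (part f (σ 0F)) →
      InducedIn P₃ ⊤ G (part f (σ 1F)) ⊎ InducedIn K₂+K₁ ⊤ G (part f (σ 1F)) → ⊥
    no-mixed-layout {true}  σ σ-inj rays pair (inj₁ path) = refute-split σ σ-inj rays P₃∣K₂ pair path
    no-mixed-layout {true}  σ σ-inj rays pair (inj₂ edge) = refute-split σ σ-inj rays K₂+K₁∣K₂ pair edge
    no-mixed-layout {false} σ σ-inj rays pair (inj₁ path) = refute-split σ σ-inj rays P₃∣2K₁ pair path
    no-mixed-layout {false} σ σ-inj rays pair (inj₂ edge) = refute-split σ σ-inj rays K₂+K₁∣2K₁ pair edge

    -- σ moves the mixed part i to position 1; position 0 then holds part 1 (if i is the first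
    -- part) or the first part itself, and the remaining positions hold parts other than the first.
    no-mixed-part : ∀ {γ} → (∀ j → toℕ j ≢ 0 → InducedIn K₂ ⊤ G (part f j)) →
      InducedIn (uniform γ 2) ⊤ G (part f 0F) → ∀ i → ¬ MixedTriple G (part f i)
    no-mixed-part edges _ 0F mixed =
      no-mixed-layout (PC.transpose 1F 0F) (transpose-injective 1F 0F)
        (λ s → edges (suc (suc s)) λ ()) (edges 1F λ ()) (mixed-induced G mixed)
    no-mixed-part edges pair₀ i@(suc _) mixed =
      no-mixed-layout σ (transpose-injective 1F i) (λ s → edges (σ (suc (suc s))) (σ-nonzero s)) pair₀
        (mixed-induced G mixed)
      where
      σ : Fin (suc (suc m)) → Fin (suc (suc m))
      σ = PC.transpose 1F i
      σ-nonzero : ∀ s → toℕ (σ (suc (suc s))) ≢ 0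
      σ-nonzero s e with () ← transpose-injective 1F i {suc (suc s)} {0F} (toℕ-injective e)

  certifying⇒uniform : ∀ {n} {G : Graph n} (f : Fin n → Fin (suc (suc m))) →
    Certifying T G f → UniformParts G f
  certifying⇒uniform {G = G} f (witnessing , _ , (cliques , first) , _)
    with clique-or-stable⇒uniform G (first 0F refl)
  ... | b₀ , big₀ = nonzero-cliques , first-uniform
    where
    edges : ∀ j → toℕ j ≢ 0 → InducedIn K₂ ⊤ G (part f j)
    edges j j≢0 = has-uniform-induced G (cliques j j≢0) 2≤t
    no-mixed : ∀ i → ¬ MixedTriple G (part f i)
    no-mixed = no-mixed-part f witnessing edges (has-uniform-induced G big₀ 2≤t)
    nonzero-cliques : ∀ i → toℕ i ≢ 0 → IsClique G (part f i)
    nonzero-cliques i i≢0 =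
      [ id , ⊥-elim ∘ no-mixed i ]′ (uniform-or-mixed G (has-uniform-induced G (cliques i i≢0) 3≤t))
    first-uniform : ∀ i → toℕ i ≡ 0 → IsClique G (part f i) ⊎ IsStable G (part f i)
    first-uniform 0F _ = [ uniform⇒clique-or-stable G b₀ , ⊥-elim ∘ no-mixed 0F ]′
      (uniform-or-mixed G (has-uniform-induced G big₀ 3≤t))

  uniform⇒certifying : ∀ {n} {G : Graph n} (f : Fin n → Fin (suc (suc m))) →
    Interesting T G f → UniformParts G f → Certifying T G f
  uniform⇒certifying {G = G} f (first-max , big) (nonzero-cliques , first-uniform) =
    witnessing , first-max , (nonzero-has-clique , λ i _ → big i) , p4-free
    where
    witnessing : Witnessing T G f
    witnessing with first-uniform 0F refl
    ... | inj₁ clique₀ = clique-parts-witness {G = G} f λ { 0F → clique₀ ; j@(suc _) → nonzero-cliques j λ () }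
    ... | inj₂ stable₀ = stable-part-witness {G = G} f 0F stable₀ λ j j≢0 → nonzero-cliques j (j≢0 ∘ toℕ-injective)
    nonzero-has-clique : ∀ i → toℕ i ≢ 0 → HasClique G (part f i) t
    nonzero-has-clique i i≢0 = [ id , (λ stable → ⊥-elim (uniform-excludes G {H = 2K₁} {Y = ⊤} {u = 0F} {1F}
      (nonzero-cliques i i≢0) ∈⊤ ∈⊤ (λ ()) refl (has-uniform-induced G stable 2≤t))) ]′ (big i)
    p4-free : ∀ i → P4Free G (part f i)
    p4-free 0F = [ uniform⇒P4Free G {true} , uniform⇒P4Free G {false} ]′ (first-uniform 0F refl)
    p4-free i@(suc _) = uniform⇒P4Free G (nonzero-cliques i λ ())

mainTheorem12 : ∀ {t} (T : Graph t) → IsSubdividedStar T →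
  ∀ (a : ℕ) → IsAlpha T ⊤ a → 3 ≤ a →
  ∀ {n} (G : Graph n) (f : Fin n → Fin (a ∸ 1)) → Interesting T G f →
  (Certifying T G f ⇔
    ((∀ i → toℕ i ≢ 0 → IsClique G (part f i)) ×
     (∀ i → toℕ i ≡ 0 → IsClique G (part f i) ⊎ IsStable G (part f i))))
mainTheorem12 T (k , φ , iso) a α 3≤a G f interesting with StarShaped.α-star T k φ iso a α
... | refl with 3≤a
... | s≤s (s≤s (s≤s _)) = mk⇔ (certifying⇒uniform {G = G} f) (uniform⇒certifying {G = G} f interesting)
  where open Characterisation T _ φ iso
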